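{- Let $k\ge 2$, $s\ge 2$, $n\ge 1$ be integers. Let $H$ be the graph with vertex set $\{u_i,v_i:1\le i\le 2k\}\cup\{x_{i,j}:1\le i\le k,\ 1\le j\le 2n+1\}$ and edges $u_iv_i$ ($1\le i\le 2k$) and $u_ix_{i,j}, v_ix_{i,j}, u_{2k+1-i}x_{i,j}, v_{2k+1-i}x_{i,j}$ ($1\le i\le k$, $1\le j\le 2n+1$), so $H\cong k(2P_2\vee O_{2n+1})$. Suppose $\{u_1,\dots,u_{2k}\}$ is partitioned into blocks each of size $s$ such that no two vertices in the same block have a common neighbor in $H$, and let $G$ be obtained from $H$ by identifying all vertices of each block into a single vertex. Then $\chi_{la}(G)=3$.
   Context: For a graph $G$ with $q$ edges, a local antimagic labeling is a bijection $f:E(G)\to\{1,\dots,q\}$ such that, writing $f^+(u)=\sum_{e\ni u}f(e)$, we have $f^+(u)\ne f^+(v)$ for every edge $uv$. $\chi_{la}(G)$ is the minimum over all local antimagic labelings of the number of distinct values of $f^+$. $aP_2$ is a disjoint union of $a$ one-edge paths, $O_m$ the edgeless graph on $m$ vertices, $\vee$ the join, $kH$ the disjoint union of $k$ copies. The family of such $G$ is denoted $\mathcal J_1(k,2n+1,s)$ in the paper. -}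

module Defs where

open import Data.Nat using (ℕ; zero; suc; _+_; _≤_)
open import Data.Fin using (Fin; toℕ; _↑ˡ_; opposite)
import Data.Fin as F
open import Data.Fin.Properties using (all?)
open import Data.List using (List; []; _∷_; _++_; map; concatMap; length; filter; allFin; lookup; deduplicate)
open import Data.Nat.ListAction using (sum)
open import Data.List.Membership.Propositional using (_∈_)
open import Data.Product using (_×_; _,_; proj₁; proj₂; ∃; Σ)
open import Data.Sum using (_⊎_)
open import Relation.Binary.PropositionalEquality using (_≡_; _≢_; refl; cong)
open import Relation.Nullary using (Dec; yes; no; ¬_)
open import Relation.Nullary.Decidable using (⌊_⌋)
open import Data.Bool using (if_then_else_)
open import Function.Definitions using (Bijective)

-- The graph H ≅ k (2P₂ ∨ O_{2n+1}), 0-indexed: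
--   u i, v i   for i : Fin (k + k)       (paper: u_{i+1}, v_{i+1})
--   x i j      for i : Fin k, j : Fin (2n+1)
-- The paper's u_{2k+1-i} is  u (opposite (i ↑ˡ k)).

data VH (k n : ℕ) : Set where
  u : Fin (k + k) → VH k n
  v : Fin (k + k) → VH k n
  x : Fin k → Fin (suc (n + n)) → VH k n

xEdges : (k n : ℕ) → Fin k → Fin (suc (n + n)) → List (VH k n × VH k n)
xEdges k n i j =
    (u (i ↑ˡ k) , x i j)
  ∷ (v (i ↑ˡ k) , x i j)
  ∷ (u (opposite (i ↑ˡ k)) , x i j)
  ∷ (v (opposite (i ↑ˡ k)) , x i j)
  ∷ []

edgesH : (k n : ℕ) → List (VH k n × VH k n)
edgesH k n =
  map (λ i → (u i , v i)) (allFin (k + k))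
  ++ concatMap (λ i → concatMap (λ j → xEdges k n i j) (allFin (suc (n + n)))) (allFin k)

AdjH : (k n : ℕ) → VH k n → VH k n → Set
AdjH k n a b = ((a , b) ∈ edgesH k n) ⊎ ((b , a) ∈ edgesH k n)

CommonNeighbour : (k n : ℕ) → VH k n → VH k n → Set
CommonNeighbour k n a b = ∃ λ w → AdjH k n a w × AdjH k n b w

-- Partition of {u_1..u_{2k}} into m blocks, given by β : Fin (k+k) → Fin m.

blockSize : (k m : ℕ) → (Fin (k + k) → Fin m) → Fin m → ℕ
blockSize k m β b = length (filter (λ i → β i F.≟ b) (allFin (k + k)))

AllBlocksOfSize : (k m : ℕ) → (Fin (k + k) → Fin m) → ℕ → Set
AllBlocksOfSize k m β s = (b : Fin m) → blockSize k m β b ≡ s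

BlocksIndependent : (k n m : ℕ) → (Fin (k + k) → Fin m) → Set
BlocksIndependent k n m β =
  (i i′ : Fin (k + k)) → i ≢ i′ → β i ≡ β i′ → ¬ CommonNeighbour k n (u i) (u i′)

-- The graph G: identify all u's of each block into one vertex U b.

data VG (k n m : ℕ) : Set where
  U : Fin m → VG k n m
  V : Fin (k + k) → VG k n m
  X : Fin k → Fin (suc (n + n)) → VG k n m

_≟G_ : {k n m : ℕ} → (a b : VG k n m) → Dec (a ≡ b)
U a ≟G U b with a F.≟ b
... | yes refl = yes refl
... | no p = no λ { refl → p refl }
U _ ≟G V _ = no λ ()
U _ ≟G X _ _ = no λ ()
V _ ≟G U _ = no λ ()
V a ≟G V b with a F.≟ b
... | yes refl = yes refl
... | no p = no λ { refl → p refl }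
V _ ≟G X _ _ = no λ ()
X _ _ ≟G U _ = no λ ()
X _ _ ≟G V _ = no λ ()
X a c ≟G X b d with a F.≟ b | c F.≟ d
... | yes refl | yes refl = yes refl
... | no p | _ = no λ { refl → p refl }
... | yes _ | no p = no λ { refl → p refl }

quot : {k n m : ℕ} → (Fin (k + k) → Fin m) → VH k n → VG k n m
quot β (u i) = U (β i)
quot β (v i) = V i
quot β (x i j) = X i j

verticesG : (k n m : ℕ) → List (VG k n m)
verticesG k n m =
  map U (allFin m) ++ map V (allFin (k + k))
  ++ concatMap (λ i → map (X i) (allFin (suc (n + n)))) (allFin k)

edgesG : (k n m : ℕ) → (Fin (k + k) → Fin m) → List (VG k n m × VG k n m)
edgesG k n m β = map (λ e → (quot β (proj₁ e) , quot β (proj₂ e))) (edgesH k n)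

-- A labeling is a bijection f : Fin q → Fin q; the label of edge e is
-- 1 + toℕ (f e), so labels range bijectively over {1,…,q}.

module _ {V : Set} (_≟_ : (a b : V) → Dec (a ≡ b))
         (vs : List V) (es : List (V × V)) where

  q : ℕ
  q = length es

  edge : Fin q → V × V
  edge = lookup es

  label : (Fin q → Fin q) → Fin q → ℕ
  label f e = suc (toℕ (f e))

  fplus : (Fin q → Fin q) → V → ℕ
  fplus f w = sum (map contrib (allFin q))
    where
    contrib : Fin q → ℕ
    contrib e = (if ⌊ w ≟ proj₁ (edge e) ⌋ then label f e else 0)
              + (if ⌊ w ≟ proj₂ (edge e) ⌋ then label f e else 0)

  IsLocalAntimagic : (Fin q → Fin q) → Set
  IsLocalAntimagic f =
    Bijective _≡_ _≡_ f ×
    ((e : Fin q) → fplus f (proj₁ (edge e)) ≢ fplus f (proj₂ (edge e)))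

  numColours : (Fin q → Fin q) → ℕ
  numColours f = length (deduplicate Data.Nat._≟_ (map (fplus f) vs))

  ChiLaEq : ℕ → Set
  ChiLaEq c =
    (Σ (Fin q → Fin q) λ f → IsLocalAntimagic f × numColours f ≡ c) ×
    ((f : Fin q → Fin q) → IsLocalAntimagic f → c ≤ numColours f)

-- Write the label of an edge as k·p + ι + 1 with a column p < 8n + 6 and a residue ι < k.
-- In the i-th copy of 2P₂ ∨ O_{2n+1} every edge gets residue i or its complement k − 1 − i,
-- so two labels with complementary residues in columns a and b add up to (k + 1) + k(a + b)
-- whatever i is. Distributing the columns so that the labels at each vertex pair up this way
-- with prescribed column sums, every u of H gets the same vertex sum A, every v the same B
-- and every x the same C. A vertex of G replacing a block of s u's collects their edges and
-- has sum sA, and C < B < 2A ≤ sA gives a local antimagic labelling with three colours; the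
-- triangle u_i v_i x_{i,j} forces at least three.

module Submission where

open import Data.Nat.Properties
open import Algebra.Properties.Semiring.Sum +-*-semiring
  using (sum-syntax; sum-cong-≗; ∑-distrib-+; *-distribˡ-sum; sum-remove; sum-replicate-zero; ∑-permute)
open import Data.Bool using (Bool; true; false; if_then_else_)
open import Data.Fin as Fin
  using (Fin; zero; suc; toℕ; fromℕ<; _↑ˡ_; _↑ʳ_; opposite; splitAt; punchIn; punchOut; remQuot)
open import Data.Fin.Patterns using (0F; 1F; 2F; 3F; 4F; 5F)
open import Data.Fin.Permutation using (reverse)
open import Data.Fin.Properties
  using ( any?; toℕ-injective; toℕ<n; toℕ-fromℕ<; toℕ-↑ˡ; toℕ-↑ʳ; opposite-prop; opposite-involutive
        ; splitAt-↑ˡ; splitAt-↑ʳ; punchInᵢ≢i; punchOut-injective; injective⇒≤; combine-remQuot; toℕ-combine)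
open import Data.List using (List; []; _∷_; _++_; map; concatMap; length; filter; allFin; tabulate; lookup; deduplicate)
open import Data.List.Membership.Propositional using (_∈_)
open import Data.List.Membership.Propositional.Properties using (∈-map⁺; ∈-map⁻; ∈-lookup; ∈-allFin)
open import Data.List.Properties
  using (map-tabulate; map-++; map-cong; map-∘; map-concatMap; concatMap-cong; length-map)
open import Data.List.Relation.Binary.Subset.Propositional using (_⊆_)
open import Data.List.Relation.Unary.All as All using (All; []; _∷_)
import Data.List.Relation.Unary.All.Properties as AllP
open import Data.List.Relation.Unary.AllPairs using ([]; _∷_)
open import Data.List.Relation.Unary.Any as Any using (Any; here; there)
import Data.List.Relation.Unary.Any.Properties as Any
open import Data.List.Relation.Unary.Unique.Propositional using (Unique)
open import Data.List.Relation.Unary.Unique.DecPropositional.Properties using (deduplicate-!)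
open import Data.Nat using (ℕ; zero; suc; _+_; _*_; _≤_; _<_; z≤n; s≤s; s≤s⁻¹; z<s)
import Data.Nat as ℕ
import Data.Nat.ListAction as List
open import Data.Nat.ListAction.Properties using (sum-++)
open import Data.Nat.Tactic.RingSolver using (solve-∀)
open import Data.Product using (_×_; _,_; proj₁; proj₂; ∃; Σ)
open import Data.Sum using (inj₁; inj₂; [_,_]′)
open import Function using (_∘_)
open import Function.Definitions using (Injective; Bijective)
open import Relation.Binary.PropositionalEquality
open import Relation.Nullary using (Dec; yes; no; ¬_; contradiction)
open import Relation.Nullary.Decidable using (⌊_⌋; isYes≗does; dec-true; dec-false)

open import Defs hiding (u; v; x)

⌊⌋-true : ∀ {A : Set} (a? : Dec A) → A → ⌊ a? ⌋ ≡ true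
⌊⌋-true a? a = trans (isYes≗does a?) (dec-true a? a)

⌊⌋-false : ∀ {A : Set} (a? : Dec A) → ¬ A → ⌊ a? ⌋ ≡ false
⌊⌋-false a? ¬a = trans (isYes≗does a?) (dec-false a? ¬a)

indicator : Bool → ℕ
indicator b = if b then 1 else 0

if-then-0 : ∀ b x → (if b then x else 0) ≡ indicator b * x
if-then-0 true  x = sym (+-identityʳ x)
if-then-0 false x = refl

if-sum : ∀ b a₁ a₂ a₃ a₄ →
  (if b then a₁ else 0) + ((if b then a₂ else 0) + ((if b then a₃ else 0) + ((if b then a₄ else 0) + 0)))
    ≡ (if b then a₁ + a₂ + a₃ + a₄ else 0)
if-sum true  = identity
  where
  identity : ∀ a b c d → a + (b + (c + (d + 0))) ≡ a + b + c + d
  identity = solve-∀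
if-sum false _ _ _ _ = refl

sum-map-allFin : ∀ {n} (f : Fin n → ℕ) → List.sum (map f (allFin n)) ≡ ∑[ i < n ] f i
sum-map-allFin {zero}  f = refl
sum-map-allFin {suc n} f = cong (f zero +_) (begin
  List.sum (map f (tabulate suc))         ≡⟨ cong List.sum (map-tabulate suc f) ⟩
  List.sum (tabulate (f ∘ suc))           ≡⟨ cong List.sum (map-tabulate (λ i → i) (f ∘ suc)) ⟨
  List.sum (map (f ∘ suc) (allFin n))     ≡⟨ sum-map-allFin (f ∘ suc) ⟩
  ∑[ i < n ] f (suc i)                    ∎)
  where open ≡-Reasoning

sum-map-concatMap : ∀ {A B : Set} (g : B → ℕ) (h : A → List B) xs →
  List.sum (map g (concatMap h xs)) ≡ List.sum (map (λ x → List.sum (map g (h x))) xs)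
sum-map-concatMap g h []       = refl
sum-map-concatMap g h (x ∷ xs) = begin
  List.sum (map g (h x ++ concatMap h xs))                 ≡⟨ cong List.sum (map-++ g (h x) _) ⟩
  List.sum (map g (h x) ++ map g (concatMap h xs))         ≡⟨ sum-++ (map g (h x)) _ ⟩
  List.sum (map g (h x)) + List.sum (map g (concatMap h xs)) ≡⟨ cong (_ +_) (sum-map-concatMap g h xs) ⟩
  List.sum (map g (h x)) + List.sum (map (λ x → List.sum (map g (h x))) xs) ∎
  where open ≡-Reasoning

length≡sum-map-1 : ∀ {A : Set} (xs : List A) → length xs ≡ List.sum (map (λ _ → 1) xs)
length≡sum-map-1 []       = refl
length≡sum-map-1 (_ ∷ xs) = cong suc (length≡sum-map-1 xs)

length-filter≡sum : ∀ {A : Set} {P : A → Set} (P? : ∀ a → Dec (P a)) xs →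
  length (filter P? xs) ≡ List.sum (map (λ a → indicator ⌊ P? a ⌋) xs)
length-filter≡sum P? []       = refl
length-filter≡sum P? (a ∷ xs) with P? a
... | yes _ = cong suc (length-filter≡sum P? xs)
... | no  _ = length-filter≡sum P? xs

∑-const : ∀ n c → ∑[ i < n ] c ≡ n * c
∑-const zero    c = refl
∑-const (suc n) c = cong (c +_) (∑-const n c)

∑-single : ∀ {n} (f : Fin n → ℕ) (i₀ : Fin n) → (∀ i → i ≢ i₀ → f i ≡ 0) → ∑[ i < n ] f i ≡ f i₀
∑-single {suc n} f i₀ vanish = begin
  ∑[ i < suc n ] f i                  ≡⟨ sum-remove {i = i₀} f ⟩
  f i₀ + ∑[ j < n ] f (punchIn i₀ j)  ≡⟨ cong (f i₀ +_) (sum-cong-≗ (λ j → vanish _ (punchInᵢ≢i i₀ j))) ⟩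
  f i₀ + ∑[ j < n ] 0                 ≡⟨ cong (f i₀ +_) (sum-replicate-zero n) ⟩
  f i₀ + 0                            ≡⟨ +-identityʳ (f i₀) ⟩
  f i₀                                ∎
  where open ≡-Reasoning

∑-↑ : ∀ m {n} (f : Fin (m + n) → ℕ) → ∑[ t < m + n ] f t ≡ ∑[ i < m ] f (i ↑ˡ n) + ∑[ j < n ] f (m ↑ʳ j)
∑-↑ zero    f = refl
∑-↑ (suc m) f = trans (cong (f zero +_) (∑-↑ m (f ∘ suc))) (sym (+-assoc (f zero) _ _))

∑-opposite : ∀ {n} (f : Fin n → ℕ) → ∑[ i < n ] f i ≡ ∑[ i < n ] f (opposite i)
∑-opposite f = ∑-permute f reverse

opposite-↑ˡ : ∀ {k} (i : Fin k) → opposite (i ↑ˡ k) ≡ k ↑ʳ opposite i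
opposite-↑ˡ {k} i = toℕ-injective (begin
  toℕ (opposite (i ↑ˡ k))         ≡⟨ opposite-prop (i ↑ˡ k) ⟩
  (k + k) ℕ.∸ suc (toℕ (i ↑ˡ k))  ≡⟨ cong (λ z → (k + k) ℕ.∸ suc z) (toℕ-↑ˡ i k) ⟩
  (k + k) ℕ.∸ suc (toℕ i)         ≡⟨ +-∸-assoc k (toℕ<n i) ⟩
  k + (k ℕ.∸ suc (toℕ i))         ≡⟨ cong (k +_) (opposite-prop i) ⟨
  k + toℕ (opposite i)            ≡⟨ toℕ-↑ʳ k (opposite i) ⟨
  toℕ (k ↑ʳ opposite i)           ∎)
  where open ≡-Reasoning

∑-pairs : ∀ {k} (f : Fin (k + k) → ℕ) →
  ∑[ t < k + k ] f t ≡ ∑[ i < k ] (f (i ↑ˡ k) + f (opposite (i ↑ˡ k)))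
∑-pairs {k} f = begin
  ∑[ t < k + k ] f t
    ≡⟨ ∑-↑ k f ⟩
  ∑ˡ + ∑[ i < k ] f (k ↑ʳ i)
    ≡⟨ cong (∑ˡ +_) (∑-opposite (f ∘ (k ↑ʳ_))) ⟩
  ∑ˡ + ∑[ i < k ] f (k ↑ʳ opposite i)
    ≡⟨ cong (∑ˡ +_) (sum-cong-≗ {x = f ∘ (k ↑ʳ_) ∘ opposite} (cong f ∘ sym ∘ opposite-↑ˡ)) ⟩
  ∑ˡ + ∑[ i < k ] f (opposite (i ↑ˡ k))
    ≡⟨ ∑-distrib-+ (f ∘ (_↑ˡ k)) (f ∘ opposite ∘ (_↑ˡ k)) ⟨
  ∑[ i < k ] (f (i ↑ˡ k) + f (opposite (i ↑ˡ k))) ∎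
  where
  open ≡-Reasoning
  ∑ˡ = ∑[ i < k ] f (i ↑ˡ k)

-- The vertex sum of a block of u's (ω its indicator) or of a single v: each position t of the
-- block contributes its whole row, which sums to R.
∑-rows : ∀ {k N} (ω g : Fin (k + k) → ℕ) (h₁ h₂ : Fin k → Fin N → ℕ) {R} →
  (∀ i → g (i ↑ˡ k) + ∑[ j < N ] h₁ i j ≡ R) →
  (∀ i → g (opposite (i ↑ˡ k)) + ∑[ j < N ] h₂ i j ≡ R) →
  ∑[ t < k + k ] (ω t * g t) + ∑[ i < k ] ∑[ j < N ] (ω (i ↑ˡ k) * h₁ i j + ω (opposite (i ↑ˡ k)) * h₂ i j)
    ≡ R * ∑[ t < k + k ] ω t
∑-rows {k} {N} ω g h₁ h₂ {R} row₁ row₂ = begin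
  ∑[ t < k + k ] (ω t * g t) + ∑[ i < k ] ∑[ j < N ] (ω (l i) * h₁ i j + ω (o i) * h₂ i j)
    ≡⟨ cong₂ _+_ (∑-pairs {k} (λ t → ω t * g t))
                 (sum-cong-≗ {x = λ i → ∑[ j < N ] (ω (l i) * h₁ i j + ω (o i) * h₂ i j)} inner) ⟩
  ∑[ i < k ] (ω (l i) * g (l i) + ω (o i) * g (o i)) + ∑[ i < k ] (ω (l i) * H₁ i + ω (o i) * H₂ i)
    ≡⟨ ∑-distrib-+ (λ i → ω (l i) * g (l i) + ω (o i) * g (o i)) (λ i → ω (l i) * H₁ i + ω (o i) * H₂ i) ⟨
  ∑[ i < k ] ((ω (l i) * g (l i) + ω (o i) * g (o i)) + (ω (l i) * H₁ i + ω (o i) * H₂ i))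
    ≡⟨ sum-cong-≗ {x = λ i → (ω (l i) * g (l i) + ω (o i) * g (o i)) + (ω (l i) * H₁ i + ω (o i) * H₂ i)} per-pair ⟩
  ∑[ i < k ] (R * (ω (l i) + ω (o i)))
    ≡⟨ *-distribˡ-sum R (λ i → ω (l i) + ω (o i)) ⟨
  R * ∑[ i < k ] (ω (l i) + ω (o i))
    ≡⟨ cong (R *_) (∑-pairs {k} ω) ⟨
  R * ∑[ t < k + k ] ω t ∎
  where
  open ≡-Reasoning
  l o : Fin k → Fin (k + k)
  l i = i ↑ˡ k
  o i = opposite (i ↑ˡ k)
  H₁ H₂ : Fin k → ℕ
  H₁ i = ∑[ j < N ] h₁ i j
  H₂ i = ∑[ j < N ] h₂ i j
  inner : ∀ i → ∑[ j < N ] (ω (l i) * h₁ i j + ω (o i) * h₂ i j) ≡ ω (l i) * H₁ i + ω (o i) * H₂ i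
  inner i = trans (∑-distrib-+ (λ j → ω (l i) * h₁ i j) (λ j → ω (o i) * h₂ i j))
                  (sym (cong₂ _+_ (*-distribˡ-sum (ω (l i)) (h₁ i)) (*-distribˡ-sum (ω (o i)) (h₂ i))))
  per-pair : ∀ i → (ω (l i) * g (l i) + ω (o i) * g (o i)) + (ω (l i) * H₁ i + ω (o i) * H₂ i) ≡ R * (ω (l i) + ω (o i))
  per-pair i = begin
    (ω (l i) * g (l i) + ω (o i) * g (o i)) + (ω (l i) * H₁ i + ω (o i) * H₂ i)
      ≡⟨ regroup (ω (l i)) (ω (o i)) (g (l i)) (g (o i)) (H₁ i) (H₂ i) ⟩
    ω (l i) * (g (l i) + H₁ i) + ω (o i) * (g (o i) + H₂ i)
      ≡⟨ cong₂ (λ a b → ω (l i) * a + ω (o i) * b) (row₁ i) (row₂ i) ⟩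
    ω (l i) * R + ω (o i) * R
      ≡⟨ factor (ω (l i)) (ω (o i)) R ⟩
    R * (ω (l i) + ω (o i)) ∎
    where
    regroup : ∀ a b c d e f → (a * c + b * d) + (a * e + b * f) ≡ a * (c + e) + b * (d + f)
    regroup = solve-∀
    factor : ∀ a b r → a * r + b * r ≡ r * (a + b)
    factor = solve-∀

all-allFin : ∀ {n} {P : Fin n → Set} → (∀ i → P i) → All P (allFin n)
all-allFin = AllP.tabulate⁺ {f = λ i → i}

any-allFin : ∀ {n} {P : Fin n → Set} i → P i → Any P (allFin n)
any-allFin = Any.tabulate⁺ {f = λ i → i}

data SplitView (m : ℕ) {n : ℕ} : Fin (m + n) → Set where
  left  : (a : Fin m) → SplitView m (a ↑ˡ n)
  right : (b : Fin n) → SplitView m (m ↑ʳ b)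

splitView : ∀ m {n} (i : Fin (m + n)) → SplitView m i
splitView zero    i       = right i
splitView (suc m) zero    = left zero
splitView (suc m) (suc i) with splitView m i
... | left a  = left (suc a)
... | right b = right b

toℕ-remQuot : ∀ {m} d (a : Fin (m * d)) → toℕ a ≡ d * toℕ (proj₁ (remQuot {m} d a)) + toℕ (proj₂ (remQuot {m} d a))
toℕ-remQuot {m} d a =
  trans (cong toℕ (sym (combine-remQuot {m} d a))) (toℕ-combine (proj₁ (remQuot {m} d a)) (proj₂ (remQuot {m} d a)))

suc-toℕ+toℕ-opposite : ∀ {n} (i : Fin n) → suc (toℕ i + toℕ (opposite i)) ≡ n
suc-toℕ+toℕ-opposite i = trans (cong (λ z → suc (toℕ i + z)) (opposite-prop i)) (m+[n∸m]≡n (toℕ<n i))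

injective⇒surjective : ∀ {n} (f : Fin n → Fin n) → Injective _≡_ _≡_ f → ∀ y → ∃ λ x → f x ≡ y
injective⇒surjective {suc n} f f-inj y with any? (λ x → f x Fin.≟ y)
... | yes hit = hit
... | no ∄x   = contradiction (injective⇒≤ punchOut∘f-injective) (<-irrefl refl)
  where
  punchOut∘f : Fin (suc n) → Fin n
  punchOut∘f x = punchOut {i = y} (λ y≡fx → ∄x (x , sym y≡fx))
  punchOut∘f-injective : Injective _≡_ _≡_ punchOut∘f
  punchOut∘f-injective {a} {b} = f-inj ∘ punchOut-injective {i = y} (λ e → ∄x (a , sym e)) (λ e → ∄x (b , sym e))

surjective⇒bijective : ∀ {n} (f : Fin n → Fin n) → (∀ y → ∃ λ x → f x ≡ y) → Bijective _≡_ _≡_ f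
surjective⇒bijective f onto = f-inj , λ y → section y , λ { refl → proj₂ (onto y) }
  where
  section = proj₁ ∘ onto
  section-inj : Injective _≡_ _≡_ section
  section-inj {a} {b} eq = trans (sym (proj₂ (onto a))) (trans (cong f eq) (proj₂ (onto b)))
  f-inj : Injective _≡_ _≡_ f
  f-inj {a} {b} fa≡fb with injective⇒surjective section section-inj a | injective⇒surjective section section-inj b
  ... | a′ , refl | b′ , refl = cong section (trans (sym (proj₂ (onto a′))) (trans fa≡fb (proj₂ (onto b′))))

module _ {A : Set} where

  remove : ∀ {x : A} xs → x ∈ xs → List A
  remove (_ ∷ ys) (here _)  = ys
  remove (y ∷ ys) (there p) = y ∷ remove ys p

  length-remove : ∀ {x : A} xs (p : x ∈ xs) → length xs ≡ suc (length (remove xs p))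
  length-remove (_ ∷ _)  (here _)  = refl
  length-remove (_ ∷ ys) (there p) = cong suc (length-remove ys p)

  ∈-remove : ∀ {x z : A} xs (p : x ∈ xs) → z ∈ xs → z ≢ x → z ∈ remove xs p
  ∈-remove (_ ∷ _)  (here refl) (here refl) z≢x = contradiction refl z≢x
  ∈-remove (_ ∷ _)  (here refl) (there q)   _   = q
  ∈-remove (_ ∷ _)  (there p)   (here refl) _   = here refl
  ∈-remove (_ ∷ ys) (there p)   (there q)   z≢x = there (∈-remove ys p q z≢x)

  Unique-⊆⇒length≤ : ∀ {xs ys : List A} → Unique xs → xs ⊆ ys → length xs ≤ length ys
  Unique-⊆⇒length≤ []                      _   = z≤n
  Unique-⊆⇒length≤ {x ∷ xs} {ys} (x∉ ∷ !xs) xs⊆ys = begin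
    suc (length xs)            ≤⟨ s≤s (Unique-⊆⇒length≤ !xs (λ z∈ → ∈-remove ys x∈ys (xs⊆ys (there z∈)) (x≢ x∉ z∈))) ⟩
    suc (length (remove ys x∈ys)) ≡⟨ length-remove ys x∈ys ⟨
    length ys                  ∎
    where
    open ≤-Reasoning
    x∈ys = xs⊆ys (here refl)
    x≢ : ∀ {z zs} → All (x ≢_) zs → z ∈ zs → z ≢ x
    x≢ (x≢z ∷ _)  (here refl) = x≢z ∘ sym
    x≢ (_ ∷ x≢zs) (there z∈)  = x≢ x≢zs z∈

length-deduplicate-≤ : ∀ {ms ns : List ℕ} → ms ⊆ ns → length (deduplicate ℕ._≟_ ms) ≤ length ns
length-deduplicate-≤ {ms} ms⊆ns =
  Unique-⊆⇒length≤ (deduplicate-! ℕ._≟_ ms) (ms⊆ns ∘ Any.deduplicate⁻ ℕ._≟_)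

three≤length-deduplicate : ∀ {a b c} {ns : List ℕ} → a ∈ ns → b ∈ ns → c ∈ ns →
  a ≢ b → a ≢ c → b ≢ c → 3 ≤ length (deduplicate ℕ._≟_ ns)
three≤length-deduplicate a∈ b∈ c∈ a≢b a≢c b≢c =
  Unique-⊆⇒length≤ ((a≢b ∷ a≢c ∷ []) ∷ (b≢c ∷ []) ∷ [] ∷ []) λ where
    (here refl)                → ∈-deduplicate a∈
    (there (here refl))        → ∈-deduplicate b∈
    (there (there (here refl))) → ∈-deduplicate c∈
  where
  ∈-deduplicate : ∀ {z ns} → z ∈ ns → z ∈ deduplicate ℕ._≟_ ns
  ∈-deduplicate = Any.deduplicate⁺ ℕ._≟_ (λ { refl p → p })

complementary-sum : ∀ {κ} ι ι′ → suc (ι + ι′) ≡ κ → ∀ {a b c} x y → a + b ≡ c →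
  suc (κ * (a + x) + ι) + suc (κ * (b + y) + ι′) ≡ suc κ + κ * (c + (x + y))
complementary-sum ι ι′ refl {a} {b} x y refl = identity ι ι′ a b x y
  where
  identity : ∀ ι ι′ a b x y → suc (suc (ι + ι′) * (a + x) + ι) + suc (suc (ι + ι′) * (b + y) + ι′)
                             ≡ suc (suc (ι + ι′)) + suc (ι + ι′) * (a + b + (x + y))
  identity = solve-∀

module Labels (k n : ℕ) where

  -- Label values k * p + ι (the label itself is one more) with column p and residue ι; in
  -- component i the residue is i (sign +) or opposite i (sign −).
  label⁺ label⁻ : Fin k → ℕ → ℕ
  label⁺ i p = k * p + toℕ i
  label⁻ i p = k * p + toℕ (opposite i)

  -- Columns 4r + t, then 4n … 4n + 5, then 4n + 6 + 4(n − 1 − r) + t (r < n, t < 4); the bases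
  -- of every row pair, and mid⁺, mid⁻, add up to 8n + 2.
  mid⁺ mid⁻ : ℕ
  mid⁺ = n * 4
  mid⁻ = n * 4 + 2

  base⁺ base⁻ : Fin n → ℕ
  base⁺ r = 4 * toℕ r
  base⁻ r = n * 4 + 6 + 4 * toℕ (opposite r)

  base⁺+base⁻ : ∀ r → base⁺ r + base⁻ r ≡ mid⁺ + mid⁻
  base⁺+base⁻ r = subst (λ ν → 4 * a + (ν * 4 + 6 + 4 * b) ≡ ν * 4 + (ν * 4 + 2))
                        (suc-toℕ+toℕ-opposite r) (identity a b)
    where
    a = toℕ r
    b = toℕ (opposite r)
    identity : ∀ a b → 4 * a + (suc (a + b) * 4 + 6 + 4 * b) ≡ suc (a + b) * 4 + (suc (a + b) * 4 + 2)
    identity = solve-∀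

  pairValue : ℕ → ℕ
  pairValue e = suc k + k * (mid⁺ + mid⁻ + e)

  data Complementary : ℕ → ℕ → Set where
    mid-pair  : Complementary mid⁺ mid⁻
    base-pair : (r : Fin n) → Complementary (base⁺ r) (base⁻ r)

  complementary : ∀ {a b} → Complementary a b → a + b ≡ mid⁺ + mid⁻
  complementary mid-pair      = refl
  complementary (base-pair r) = base⁺+base⁻ r

  pair⁺⁻ : ∀ i {a b} → Complementary a b → ∀ x y →
    suc (label⁺ i (a + x)) + suc (label⁻ i (b + y)) ≡ pairValue (x + y)
  pair⁺⁻ i c x y = complementary-sum (toℕ i) (toℕ (opposite i)) (suc-toℕ+toℕ-opposite i) x y (complementary c)

  pair⁻⁺ : ∀ i {a b} → Complementary a b → ∀ x y →
    suc (label⁻ i (b + y)) + suc (label⁺ i (a + x)) ≡ pairValue (x + y)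
  pair⁻⁺ i {a} {b} c x y = trans (+-comm (suc (label⁻ i (b + y))) _) (pair⁺⁻ i c x y)

  pairValue-+ : ∀ {a b c d} → a + b ≡ c + d → pairValue a + pairValue b ≡ pairValue c + pairValue d
  pairValue-+ {a} {b} {c} {d} a+b≡c+d = begin
    pairValue a + pairValue b               ≡⟨ identity k (mid⁺ + mid⁻) a b ⟩
    2 * suc k + k * (2 * (mid⁺ + mid⁻) + (a + b)) ≡⟨ cong (λ z → 2 * suc k + k * (2 * (mid⁺ + mid⁻) + z)) a+b≡c+d ⟩
    2 * suc k + k * (2 * (mid⁺ + mid⁻) + (c + d)) ≡⟨ identity k (mid⁺ + mid⁻) c d ⟨
    pairValue c + pairValue d               ∎
    where
    open ≡-Reasoning
    identity : ∀ k S a b → (suc k + k * (S + a)) + (suc k + k * (S + b)) ≡ 2 * suc k + k * (2 * S + (a + b))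
    identity = solve-∀

  P : ℕ
  P = n * 4 + (6 + n * 4)

  column-< : ∀ {a b} → a + b ≡ mid⁺ + mid⁻ → (t : Fin 4) → a + toℕ t < P
  column-< {a} {b} a+b t = begin-strict
    a + toℕ t            ≤⟨ +-mono-≤ (m≤m+n a b) (s≤s⁻¹ (toℕ<n t)) ⟩
    a + b + 3            ≡⟨ cong (_+ 3) a+b ⟩
    mid⁺ + mid⁻ + 3      <⟨ n<1+n _ ⟩
    suc (mid⁺ + mid⁻ + 3) ≡⟨ identity n ⟩
    P                    ∎
    where
    open ≤-Reasoning
    identity : ∀ n → suc (n * 4 + (n * 4 + 2) + 3) ≡ n * 4 + (6 + n * 4)
    identity = solve-∀

  label-< : ∀ {a b} (ι : Fin k) → a + b ≡ mid⁺ + mid⁻ → (t : Fin 4) → k * (a + toℕ t) + toℕ ι < P * k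
  label-< {a} ι a+b t = begin-strict
    k * p + toℕ ι   <⟨ +-monoʳ-< (k * p) (toℕ<n ι) ⟩
    k * p + k       ≡⟨ +-comm (k * p) k ⟩
    k + k * p       ≡⟨ *-suc k p ⟨
    k * suc p       ≤⟨ *-monoʳ-≤ k (column-< a+b t) ⟩
    k * P           ≡⟨ *-comm k P ⟩
    P * k           ∎
    where
    open ≤-Reasoning
    p = a + toℕ t

  label⁺-< : ∀ i {a b} → Complementary a b → (t : Fin 4) → label⁺ i (a + toℕ t) < P * k
  label⁺-< i c = label-< i (complementary c)

  label⁻-< : ∀ i {a b} → Complementary a b → (t : Fin 4) → label⁻ i (b + toℕ t) < P * k
  label⁻-< i {a} {b} c = label-< (opposite i) (trans (+-comm b a) (complementary c))

  data Column : ℕ → Set where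
    low  : (r : Fin n) (t : Fin 4) → Column (base⁺ r + toℕ t)
    mid  : (d : Fin 6) → Column (mid⁺ + toℕ d)
    high : (r : Fin n) (t : Fin 4) → Column (base⁻ r + toℕ t)

  column : (p : Fin P) → Column (toℕ p)
  column p with splitView (n * 4) p
  ... | left a = subst Column (sym (trans (toℕ-↑ˡ a _) (toℕ-remQuot {n} 4 a))) (low r t)
    where
    r = proj₁ (remQuot {n} 4 a)
    t = proj₂ (remQuot {n} 4 a)
  ... | right b with splitView 6 b
  ...   | left d  = subst Column (sym (trans (toℕ-↑ʳ (n * 4) _) (cong (mid⁺ +_) (toℕ-↑ˡ d _)))) (mid d)
  ...   | right w = subst Column column≡ (high (opposite R) t)
    where
    R = proj₁ (remQuot {n} 4 w)
    t = proj₂ (remQuot {n} 4 w)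
    column≡ : base⁻ (opposite R) + toℕ t ≡ toℕ (n * 4 ↑ʳ (6 ↑ʳ w))
    column≡ = begin
      n * 4 + 6 + 4 * toℕ (opposite (opposite R)) + toℕ t ≡⟨ cong (λ ρ → n * 4 + 6 + 4 * toℕ ρ + toℕ t) (opposite-involutive R) ⟩
      n * 4 + 6 + 4 * toℕ R + toℕ t                     ≡⟨ identity (n * 4) (toℕ R) (toℕ t) ⟩
      n * 4 + (6 + (4 * toℕ R + toℕ t))                 ≡⟨ cong (λ z → n * 4 + (6 + z)) (toℕ-remQuot {n} 4 w) ⟨
      n * 4 + (6 + toℕ w)                               ≡⟨ cong (n * 4 +_) (toℕ-↑ʳ 6 w) ⟨
      n * 4 + toℕ (6 ↑ʳ w)                              ≡⟨ toℕ-↑ʳ (n * 4) (6 ↑ʳ w) ⟨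
      toℕ (n * 4 ↑ʳ (6 ↑ʳ w))                           ∎
      where
      open ≡-Reasoning
      identity : ∀ a b c → a + 6 + 4 * b + c ≡ a + (6 + (4 * b + c))
      identity = solve-∀

  sumU sumV sumX : ℕ
  sumU = pairValue 4 + n * pairValue 1
  sumV = pairValue 2 + n * pairValue 5
  sumX = pairValue 5 + pairValue 1

  N : ℕ
  N = suc (n + n)

  -- The 2n + 1 vertices x_{i,j} of a component: one centre and n pairs (first r, second r),
  -- whose rows carry complementary columns.
  data XIndex : Set where
    centre : XIndex
    first second : Fin n → XIndex

  xIndex : Fin N → XIndex
  xIndex zero    = centre
  xIndex (suc j) = [ first , second ]′ (splitAt n j)

  xIndex-first : ∀ r → xIndex (suc (r ↑ˡ n)) ≡ first r
  xIndex-first r rewrite splitAt-↑ˡ n r n = refl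

  xIndex-second : ∀ r → xIndex (suc (n ↑ʳ r)) ≡ second r
  xIndex-second r rewrite splitAt-↑ʳ n n r = refl

  row-sum : ∀ g (h : XIndex → ℕ) {c₀ c} → g + h centre ≡ c₀ → (∀ r → h (first r) + h (second r) ≡ c) →
    g + ∑[ j < N ] h (xIndex j) ≡ c₀ + n * c
  row-sum g h {c₀} {c} g+h₀ h₁+h₂ = begin
    g + (h centre + ∑[ j < n + n ] h (xIndex (suc j)))
      ≡⟨ cong (λ z → g + (h centre + z)) (∑-↑ n (h ∘ xIndex ∘ suc)) ⟩
    g + (h centre + (∑[ r < n ] h (xIndex (suc (r ↑ˡ n))) + ∑[ r < n ] h (xIndex (suc (n ↑ʳ r)))))
      ≡⟨ cong (λ z → g + (h centre + z)) (cong₂ _+_ (sum-cong-≗ {x = h ∘ xIndex ∘ suc ∘ (_↑ˡ n)} (cong h ∘ xIndex-first))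
                                                    (sum-cong-≗ {x = h ∘ xIndex ∘ suc ∘ (n ↑ʳ_)} (cong h ∘ xIndex-second))) ⟩
    g + (h centre + (∑[ r < n ] h (first r) + ∑[ r < n ] h (second r)))
      ≡⟨ +-assoc g (h centre) _ ⟨
    g + h centre + (∑[ r < n ] h (first r) + ∑[ r < n ] h (second r))
      ≡⟨ cong₂ _+_ g+h₀ (sym (∑-distrib-+ (h ∘ first) (h ∘ second))) ⟩
    c₀ + ∑[ r < n ] (h (first r) + h (second r))
      ≡⟨ cong (c₀ +_) (trans (sum-cong-≗ {x = λ r → h (first r) + h (second r)} h₁+h₂) (∑-const n c)) ⟩
    c₀ + n * c ∎
    where open ≡-Reasoning

  -- Labels of the edges u_i x, v_i x, u_{2k+1-i} x, v_{2k+1-i} x at a vertex x of component i.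
  ℓa ℓb ℓc ℓd : Fin k → XIndex → ℕ
  ℓa i centre     = label⁻ i (mid⁻ + 3)
  ℓa i (first r)  = label⁺ i (base⁺ r + 0)
  ℓa i (second r) = label⁻ i (base⁻ r + 1)
  ℓb i centre     = label⁻ i (mid⁻ + 1)
  ℓb i (first r)  = label⁻ i (base⁻ r + 2)
  ℓb i (second r) = label⁺ i (base⁺ r + 3)
  ℓc i centre     = label⁺ i (mid⁺ + 2)
  ℓc i (first r)  = label⁺ i (base⁺ r + 1)
  ℓc i (second r) = label⁻ i (base⁻ r + 0)
  ℓd i centre     = label⁺ i (mid⁺ + 0)
  ℓd i (first r)  = label⁻ i (base⁻ r + 3)
  ℓd i (second r) = label⁺ i (base⁺ r + 2)

  -- Position k ↑ʳ ι is opposite (i ↑ˡ k) for i = opposite ι, so that half carries label⁻ i.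
  uvLabel : Fin (k + k) → ℕ
  uvLabel t = [ (λ i → label⁺ i (mid⁺ + 1)) , (λ ι → k * (mid⁻ + 2) + toℕ ι) ]′ (splitAt k t)

  uvLabel-↑ˡ : ∀ i → uvLabel (i ↑ˡ k) ≡ label⁺ i (mid⁺ + 1)
  uvLabel-↑ˡ i rewrite splitAt-↑ˡ k i k = refl

  uvLabel-↑ʳ : ∀ ι → uvLabel (k ↑ʳ ι) ≡ k * (mid⁻ + 2) + toℕ ι
  uvLabel-↑ʳ ι rewrite splitAt-↑ʳ k k ι = refl

  uvLabel-opposite : ∀ i → uvLabel (opposite (i ↑ˡ k)) ≡ label⁻ i (mid⁻ + 2)
  uvLabel-opposite i = trans (cong uvLabel (opposite-↑ˡ i)) (uvLabel-↑ʳ (opposite i))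

  sumU-left : ∀ i → suc (uvLabel (i ↑ˡ k)) + ∑[ j < N ] suc (ℓa i (xIndex j)) ≡ sumU
  sumU-left i = row-sum (suc (uvLabel (i ↑ˡ k))) (suc ∘ ℓa i)
    (subst (λ l → suc l + suc (ℓa i centre) ≡ _) (sym (uvLabel-↑ˡ i)) (pair⁺⁻ i mid-pair 1 3))
    (λ r → pair⁺⁻ i (base-pair r) 0 1)

  sumU-right : ∀ i → suc (uvLabel (opposite (i ↑ˡ k))) + ∑[ j < N ] suc (ℓc i (xIndex j)) ≡ sumU
  sumU-right i = row-sum (suc (uvLabel (opposite (i ↑ˡ k)))) (suc ∘ ℓc i)
    (subst (λ l → suc l + suc (ℓc i centre) ≡ _) (sym (uvLabel-opposite i)) (pair⁻⁺ i mid-pair 2 2))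
    (λ r → pair⁺⁻ i (base-pair r) 1 0)

  sumV-left : ∀ i → suc (uvLabel (i ↑ˡ k)) + ∑[ j < N ] suc (ℓb i (xIndex j)) ≡ sumV
  sumV-left i = row-sum (suc (uvLabel (i ↑ˡ k))) (suc ∘ ℓb i)
    (subst (λ l → suc l + suc (ℓb i centre) ≡ _) (sym (uvLabel-↑ˡ i)) (pair⁺⁻ i mid-pair 1 1))
    (λ r → pair⁻⁺ i (base-pair r) 3 2)

  sumV-right : ∀ i → suc (uvLabel (opposite (i ↑ˡ k))) + ∑[ j < N ] suc (ℓd i (xIndex j)) ≡ sumV
  sumV-right i = row-sum (suc (uvLabel (opposite (i ↑ˡ k)))) (suc ∘ ℓd i)
    (subst (λ l → suc l + suc (ℓd i centre) ≡ _) (sym (uvLabel-opposite i)) (pair⁻⁺ i mid-pair 0 2))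
    (λ r → pair⁻⁺ i (base-pair r) 2 3)

  sumX-column : ∀ i c → suc (ℓa i c) + suc (ℓb i c) + suc (ℓc i c) + suc (ℓd i c) ≡ sumX
  sumX-column i centre = trans (swap-middle (suc (ℓa i centre)) _ _ _)
    (cong₂ _+_ (pair⁻⁺ i mid-pair 2 3) (pair⁻⁺ i mid-pair 0 1))
    where
    swap-middle : ∀ a b c d → a + b + c + d ≡ (a + c) + (b + d)
    swap-middle = solve-∀
  sumX-column i (first r) = trans (+-assoc (suc (ℓa i (first r)) + _) _ _)
    (trans (cong₂ _+_ (pair⁺⁻ i (base-pair r) 0 2) (pair⁺⁻ i (base-pair r) 1 3)) (pairValue-+ refl))
  sumX-column i (second r) = trans (+-assoc (suc (ℓa i (second r)) + _) _ _)
    (trans (cong₂ _+_ (pair⁻⁺ i (base-pair r) 3 1) (pair⁻⁺ i (base-pair r) 2 0)) (pairValue-+ refl))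

  ℓ-bounded : ∀ i c → All (_< P * k) (ℓa i c ∷ ℓb i c ∷ ℓc i c ∷ ℓd i c ∷ [])
  ℓ-bounded i centre =
    label⁻-< i mid-pair 3F ∷ label⁻-< i mid-pair 1F ∷ label⁺-< i mid-pair 2F ∷ label⁺-< i mid-pair 0F ∷ []
  ℓ-bounded i (first r) =
    label⁺-< i (base-pair r) 0F ∷ label⁻-< i (base-pair r) 2F ∷ label⁺-< i (base-pair r) 1F ∷ label⁻-< i (base-pair r) 3F ∷ []
  ℓ-bounded i (second r) =
    label⁻-< i (base-pair r) 1F ∷ label⁺-< i (base-pair r) 3F ∷ label⁻-< i (base-pair r) 0F ∷ label⁺-< i (base-pair r) 2F ∷ []

  uvLabel-< : ∀ t → uvLabel t < P * k
  uvLabel-< t with splitAt k t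
  ... | inj₁ i = label⁺-< i mid-pair 1F
  ... | inj₂ ι = label-< ι (+-comm mid⁻ mid⁺) 2F

module LabelledEdges {Vtx : Set} (_≟_ : (a b : Vtx) → Dec (a ≡ b)) (vs : List Vtx) where

  -- An entry ((a , b) , l) is an edge ab carrying the label l + 1.
  Entry : Set
  Entry = (Vtx × Vtx) × ℕ

  weight : Vtx → Entry → ℕ
  weight w (e , l) = (if ⌊ w ≟ proj₁ e ⌋ then suc l else 0) + (if ⌊ w ≟ proj₂ e ⌋ then suc l else 0)

  -- Indexed like the edge list map proj₁ L, since Fin (length (map proj₁ L)) is not
  -- definitionally Fin (length L).
  labelAt : (L : List Entry) → Fin (length (map proj₁ L)) → ℕ
  labelAt (z ∷ _) zero    = proj₂ z
  labelAt (_ ∷ L) (suc e) = labelAt L e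

  labelAt-< : ∀ {b} L → All (λ z → proj₂ z < b) L → ∀ e → labelAt L e < b
  labelAt-< (_ ∷ _) (z<b ∷ _)   zero    = z<b
  labelAt-< (_ ∷ L) (_ ∷ L<b)   (suc e) = labelAt-< L L<b e

  labelAt-index : ∀ L {y} → Any (λ z → proj₂ z ≡ y) L → ∃ λ e → labelAt L e ≡ y
  labelAt-index (_ ∷ _) (here z≡y) = zero , z≡y
  labelAt-index (_ ∷ L) (there p)  with e , eq ← labelAt-index L p = suc e , eq

  ∑-labelAt : ∀ (g : Entry → ℕ) L →
    ∑[ e < length (map proj₁ L) ] g (lookup (map proj₁ L) e , labelAt L e) ≡ List.sum (map g L)
  ∑-labelAt g []      = refl
  ∑-labelAt g (z ∷ L) = cong (g z +_) (∑-labelAt g L)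

  module _ (L : List Entry) (bounded : All (λ z → proj₂ z < length (map proj₁ L)) L) where

    labelling : Fin (length (map proj₁ L)) → Fin (length (map proj₁ L))
    labelling e = fromℕ< (labelAt-< L bounded e)

    fplus-labelling : ∀ w → fplus _≟_ vs (map proj₁ L) labelling w ≡ List.sum (map (weight w) L)
    fplus-labelling w = begin
      fplus _≟_ vs (map proj₁ L) labelling w
        ≡⟨ sum-map-allFin (λ e → weight w (lookup (map proj₁ L) e , toℕ (labelling e))) ⟩
      ∑[ e < length (map proj₁ L) ] weight w (lookup (map proj₁ L) e , toℕ (labelling e))
        ≡⟨ sum-cong-≗ (λ e → cong (λ l → weight w (lookup (map proj₁ L) e , l)) (toℕ-fromℕ< (labelAt-< L bounded e))) ⟩
      ∑[ e < length (map proj₁ L) ] weight w (lookup (map proj₁ L) e , labelAt L e)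
        ≡⟨ ∑-labelAt (weight w) L ⟩
      List.sum (map (weight w) L) ∎
      where open ≡-Reasoning

    numColours-labelling : (colour : Vtx → ℕ) → (∀ w → List.sum (map (weight w) L) ≡ colour w) →
      numColours _≟_ vs (map proj₁ L) labelling ≡ length (deduplicate ℕ._≟_ (map colour vs))
    numColours-labelling colour weight≡colour =
      cong (length ∘ deduplicate ℕ._≟_) (map-cong (λ w → trans (fplus-labelling w) (weight≡colour w)) vs)

    labelling-isLocalAntimagic :
      (∀ y → y < length (map proj₁ L) → Any (λ z → proj₂ z ≡ y) L) →
      (colour : Vtx → ℕ) → (∀ w → List.sum (map (weight w) L) ≡ colour w) →
      All (λ e → colour (proj₁ e) ≢ colour (proj₂ e)) (map proj₁ L) →
      IsLocalAntimagic _≟_ vs (map proj₁ L) labelling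
    labelling-isLocalAntimagic onto colour weight≡colour proper = surjective⇒bijective labelling labelling-onto , fplus-proper
      where
      labelling-onto : ∀ y → ∃ λ e → labelling e ≡ y
      labelling-onto y with e , eq ← labelAt-index L (onto (toℕ y) (toℕ<n y)) =
        e , toℕ-injective (trans (toℕ-fromℕ< (labelAt-< L bounded e)) eq)
      fplus≡colour : ∀ w → fplus _≟_ vs (map proj₁ L) labelling w ≡ colour w
      fplus≡colour w = trans (fplus-labelling w) (weight≡colour w)
      fplus-proper : ∀ e → fplus _≟_ vs (map proj₁ L) labelling (proj₁ (lookup (map proj₁ L) e))
                         ≢ fplus _≟_ vs (map proj₁ L) labelling (proj₂ (lookup (map proj₁ L) e))
      fplus-proper e eq = All.lookup proper (∈-lookup e) (trans (sym (fplus≡colour _)) (trans eq (fplus≡colour _)))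

  triangle⇒3≤numColours : ∀ {es f a b c} → IsLocalAntimagic _≟_ vs es f →
    a ∈ vs → b ∈ vs → c ∈ vs → (a , b) ∈ es → (a , c) ∈ es → (b , c) ∈ es →
    3 ≤ numColours _≟_ vs es f
  triangle⇒3≤numColours {es} {f} (_ , proper) a∈ b∈ c∈ ab ac bc =
    three≤length-deduplicate (∈-map⁺ _ a∈) (∈-map⁺ _ b∈) (∈-map⁺ _ c∈) (adjacent ab) (adjacent ac) (adjacent bc)
    where
    adjacent : ∀ {a b} → (a , b) ∈ es → fplus _≟_ vs es f a ≢ fplus _≟_ vs es f b
    adjacent p = subst (λ e → fplus _≟_ vs es f (proj₁ e) ≢ fplus _≟_ vs es f (proj₂ e))
                       (sym (Any.lookup-index p)) (proper (Any.index p))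

module Construction (k n m : ℕ) (β : Fin (k + k) → Fin m) where

  open Labels k n
  open LabelledEdges (_≟G_ {k} {n} {m}) (verticesG k n m)

  -- _≟G_ at the fixed k n m, which X i j alone does not determine.
  _≟ᴳ_ : (a b : VG k n m) → Dec (a ≡ b)
  _≟ᴳ_ = _≟G_

  uvEntry : Fin (k + k) → Entry
  uvEntry t = (U (β t) , V t) , uvLabel t

  xEntriesAt : Fin k → Fin N → XIndex → List Entry
  xEntriesAt i j c =
      ((U (β (i ↑ˡ k)) , X i j) , ℓa i c)
    ∷ ((V (i ↑ˡ k) , X i j) , ℓb i c)
    ∷ ((U (β (opposite (i ↑ˡ k))) , X i j) , ℓc i c)
    ∷ ((V (opposite (i ↑ˡ k)) , X i j) , ℓd i c)
    ∷ []

  xEntries : Fin k → Fin N → List Entry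
  xEntries i j = xEntriesAt i j (xIndex j)

  entries : List Entry
  entries = map uvEntry (allFin (k + k)) ++ concatMap (λ i → concatMap (xEntries i) (allFin N)) (allFin k)

  entries-edges : map proj₁ entries ≡ edgesG k n m β
  entries-edges = begin
    map proj₁ (uvs ++ xs)                  ≡⟨ map-++ proj₁ uvs xs ⟩
    map proj₁ uvs ++ map proj₁ xs          ≡⟨ cong₂ _++_ uv-part x-part ⟩
    map quotEdge uvsH ++ map quotEdge xsH  ≡⟨ map-++ quotEdge uvsH xsH ⟨
    edgesG k n m β                         ∎
    where
    open ≡-Reasoning
    quotEdge : VH k n × VH k n → VG k n m × VG k n m
    quotEdge e = quot β (proj₁ e) , quot β (proj₂ e)
    uvs = map uvEntry (allFin (k + k))
    xs = concatMap (λ i → concatMap (xEntries i) (allFin N)) (allFin k)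
    uvsH = map (λ t → (VH.u t , VH.v t)) (allFin (k + k))
    xsH = concatMap (λ i → concatMap (xEdges k n i) (allFin N)) (allFin k)
    uv-part : map proj₁ uvs ≡ map quotEdge uvsH
    uv-part = trans (sym (map-∘ (allFin (k + k)))) (map-∘ (allFin (k + k)))
    x-part : map proj₁ xs ≡ map quotEdge xsH
    x-part = trans (map-concatMap proj₁ (λ i → concatMap (xEntries i) (allFin N)) (allFin k))
      (trans (concatMap-cong (λ i → trans (map-concatMap proj₁ (xEntries i) (allFin N))
                                          (sym (map-concatMap quotEdge (xEdges k n i) (allFin N)))) (allFin k))
             (sym (map-concatMap quotEdge (λ i → concatMap (xEdges k n i) (allFin N)) (allFin k))))

  All-entries : ∀ {P : Entry → Set} → (∀ t → P (uvEntry t)) → (∀ i j → All P (xEntries i j)) → All P entries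
  All-entries uv xs = AllP.++⁺ (AllP.map⁺ (all-allFin uv))
    (AllP.concat⁺ (AllP.map⁺ (all-allFin λ i → AllP.concat⁺ (AllP.map⁺ (all-allFin (xs i))))))

  any-uvEntry : ∀ {P : Entry → Set} t → P (uvEntry t) → Any P entries
  any-uvEntry t p = Any.++⁺ˡ (Any.map⁺ (any-allFin t p))

  any-xEntries : ∀ {P : Entry → Set} i j → Any P (xEntries i j) → Any P entries
  any-xEntries i j p =
    Any.++⁺ʳ (map uvEntry (allFin (k + k)))
      (Any.concatMap⁺ (λ i → concatMap (xEntries i) (allFin N)) (any-allFin i (Any.concatMap⁺ (xEntries i) (any-allFin j p))))

  sum-map-entries : ∀ (g : Entry → ℕ) → List.sum (map g entries)
    ≡ ∑[ t < k + k ] g (uvEntry t) + ∑[ i < k ] ∑[ j < N ] List.sum (map g (xEntries i j))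
  sum-map-entries g = begin
    List.sum (map g (uvs ++ xs))                ≡⟨ cong List.sum (map-++ g uvs xs) ⟩
    List.sum (map g uvs ++ map g xs)            ≡⟨ sum-++ (map g uvs) (map g xs) ⟩
    List.sum (map g uvs) + List.sum (map g xs)  ≡⟨ cong₂ _+_ uv-part x-part ⟩
    ∑[ t < k + k ] g (uvEntry t) + ∑[ i < k ] ∑[ j < N ] List.sum (map g (xEntries i j)) ∎
    where
    open ≡-Reasoning
    uvs = map uvEntry (allFin (k + k))
    xs = concatMap (λ i → concatMap (xEntries i) (allFin N)) (allFin k)
    uv-part = trans (cong List.sum (sym (map-∘ (allFin (k + k))))) (sum-map-allFin (g ∘ uvEntry))
    x-part = trans (sum-map-concatMap g (λ i → concatMap (xEntries i) (allFin N)) (allFin k))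
      (trans (sum-map-allFin (λ i → List.sum (map g (concatMap (xEntries i) (allFin N)))))
        (sum-cong-≗ {x = λ i → List.sum (map g (concatMap (xEntries i) (allFin N)))}
          (λ i → trans (sum-map-concatMap g (xEntries i) (allFin N)) (sum-map-allFin (λ j → List.sum (map g (xEntries i j)))))))

  length-entries : length (map proj₁ entries) ≡ P * k
  length-entries = begin
    length (map proj₁ entries)                     ≡⟨ length-map proj₁ entries ⟩
    length entries                                 ≡⟨ length≡sum-map-1 entries ⟩
    List.sum (map (λ _ → 1) entries)               ≡⟨ sum-map-entries (λ _ → 1) ⟩
    ∑[ t < k + k ] 1 + ∑[ i < k ] ∑[ j < N ] 4
      ≡⟨ cong₂ _+_ (∑-const (k + k) 1)
                   (trans (sum-cong-≗ {k} {λ _ → ∑[ j < N ] 4} {λ _ → N * 4} (λ _ → ∑-const N 4)) (∑-const k (N * 4))) ⟩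
    (k + k) * 1 + k * (N * 4)                      ≡⟨ identity k n ⟩
    P * k                                          ∎
    where
    open ≡-Reasoning
    identity : ∀ k n → (k + k) * 1 + k * (suc (n + n) * 4) ≡ (n * 4 + (6 + n * 4)) * k
    identity = solve-∀

  entries-bounded : All (λ z → proj₂ z < length (map proj₁ entries)) entries
  entries-bounded = subst (λ b → All (λ z → proj₂ z < b) entries) (sym length-entries)
    (All-entries uvLabel-< (λ i j → AllP.map⁻ (ℓ-bounded i (xIndex j))))

  Hit : ℕ → Set
  Hit y = Any (λ z → proj₂ z ≡ y) entries

  hit-x : ∀ {y} i j {c} → xIndex j ≡ c → Any (λ z → proj₂ z ≡ y) (xEntriesAt i j c) → Hit y
  hit-x i j refl = any-xEntries i j

  label⁻-opposite : ∀ ι {p p′} → p ≡ p′ → label⁻ (opposite ι) p ≡ k * p′ + toℕ ι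
  label⁻-opposite ι {p} refl = cong (λ ρ → k * p + toℕ ρ) (opposite-involutive ι)

  -- The edge with label value k * p + ι lies in component ι if column p has sign +, and in
  -- component opposite ι otherwise.
  hit : (ι : Fin k) → ∀ {p} → Column p → Hit (k * p + toℕ ι)
  hit ι (low r 0F)  = hit-x ι (suc (r ↑ˡ n)) (xIndex-first r) (here refl)
  hit ι (low r 1F)  = hit-x ι (suc (r ↑ˡ n)) (xIndex-first r) (there (there (here refl)))
  hit ι (low r 2F)  = hit-x ι (suc (n ↑ʳ r)) (xIndex-second r) (there (there (there (here refl))))
  hit ι (low r 3F)  = hit-x ι (suc (n ↑ʳ r)) (xIndex-second r) (there (here refl))
  hit ι (mid 0F)    = hit-x ι zero refl (there (there (there (here refl))))
  hit ι (mid 1F)    = any-uvEntry (ι ↑ˡ k) (uvLabel-↑ˡ ι)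
  hit ι (mid 2F)    = hit-x ι zero refl (there (there (here refl)))
  hit ι (mid 3F)    = hit-x (opposite ι) zero refl (there (here (label⁻-opposite ι (+-assoc mid⁺ 2 1))))
  hit ι (mid 4F)    = any-uvEntry (k ↑ʳ ι) (trans (uvLabel-↑ʳ ι) (cong (λ p → k * p + toℕ ι) (+-assoc mid⁺ 2 2)))
  hit ι (mid 5F)    = hit-x (opposite ι) zero refl (here (label⁻-opposite ι (+-assoc mid⁺ 2 3)))
  hit ι (high r 0F) = hit-x (opposite ι) (suc (n ↑ʳ r)) (xIndex-second r) (there (there (here (label⁻-opposite ι refl))))
  hit ι (high r 1F) = hit-x (opposite ι) (suc (n ↑ʳ r)) (xIndex-second r) (here (label⁻-opposite ι refl))
  hit ι (high r 2F) = hit-x (opposite ι) (suc (r ↑ˡ n)) (xIndex-first r) (there (here (label⁻-opposite ι refl)))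
  hit ι (high r 3F) = hit-x (opposite ι) (suc (r ↑ˡ n)) (xIndex-first r) (there (there (there (here (label⁻-opposite ι refl)))))

  entries-onto : ∀ y → y < length (map proj₁ entries) → Hit y
  entries-onto y y< = subst Hit (trans (sym (toℕ-remQuot {P} k y′)) (toℕ-fromℕ< _)) (hit ι (column p))
    where
    y′ : Fin (P * k)
    y′ = fromℕ< (subst (y <_) length-entries y<)
    p = proj₁ (remQuot {P} k y′)
    ι = proj₂ (remQuot {P} k y′)

  ⌊U≟U⌋ : ∀ a c → ⌊ U a ≟ᴳ U c ⌋ ≡ ⌊ c Fin.≟ a ⌋
  ⌊U≟U⌋ a c with c Fin.≟ a
  ... | yes refl = ⌊⌋-true (U a ≟ᴳ U a) refl
  ... | no  c≢a  = ⌊⌋-false (U a ≟ᴳ U c) λ { refl → c≢a refl }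

  ⌊V≟V⌋ : ∀ a c → ⌊ V a ≟ᴳ V c ⌋ ≡ ⌊ a Fin.≟ c ⌋
  ⌊V≟V⌋ a c with a Fin.≟ c
  ... | yes refl = refl
  ... | no  _    = refl

  -- The weight of a u or v on the four entries at an x-vertex, in normal form.
  drop-zeros : ∀ a c → (a + 0) + ((c + 0) + 0) ≡ a + c
  drop-zeros = solve-∀

  vertexSum : VG k n m → ℕ
  vertexSum w = List.sum (map (weight w) entries)

  vertexSum-U : ∀ b → vertexSum (U b) ≡ sumU * blockSize k m β b
  vertexSum-U b = begin
    vertexSum (U b)
      ≡⟨ sum-map-entries (weight (U b)) ⟩
    ∑[ t < k + k ] weight (U b) (uvEntry t) + ∑[ i < k ] ∑[ j < N ] List.sum (map (weight (U b)) (xEntries i j))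
      ≡⟨ cong₂ _+_ (sum-cong-≗ {x = weight (U b) ∘ uvEntry} weight-uv)
                   (sum-cong-≗ {x = λ i → ∑[ j < N ] List.sum (map (weight (U b)) (xEntries i j))}
                               (λ i → sum-cong-≗ {x = λ j → List.sum (map (weight (U b)) (xEntries i j))} (weight-x i))) ⟩
    ∑[ t < k + k ] (ω t * suc (uvLabel t))
      + ∑[ i < k ] ∑[ j < N ] (ω (i ↑ˡ k) * suc (ℓa i (xIndex j)) + ω (opposite (i ↑ˡ k)) * suc (ℓc i (xIndex j)))
      ≡⟨ ∑-rows ω (suc ∘ uvLabel) (λ i j → suc (ℓa i (xIndex j))) (λ i j → suc (ℓc i (xIndex j))) sumU-left sumU-right ⟩
    sumU * ∑[ t < k + k ] ω t
      ≡⟨ cong (sumU *_) (trans (length-filter≡sum (λ t → β t Fin.≟ b) (allFin (k + k))) (sum-map-allFin ω)) ⟨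
    sumU * blockSize k m β b ∎
    where
    open ≡-Reasoning
    ω : Fin (k + k) → ℕ
    ω t = indicator ⌊ β t Fin.≟ b ⌋
    if-U : ∀ t l → (if ⌊ U b ≟ᴳ U (β t) ⌋ then l else 0) ≡ ω t * l
    if-U t l = trans (cong (λ c → if c then l else 0) (⌊U≟U⌋ b (β t))) (if-then-0 _ l)
    weight-uv : ∀ t → weight (U b) (uvEntry t) ≡ ω t * suc (uvLabel t)
    weight-uv t = trans (+-identityʳ _) (if-U t _)
    weight-x : ∀ i j → List.sum (map (weight (U b)) (xEntries i j))
                     ≡ ω (i ↑ˡ k) * suc (ℓa i (xIndex j)) + ω (opposite (i ↑ˡ k)) * suc (ℓc i (xIndex j))
    weight-x i j = trans (drop-zeros (if ⌊ U b ≟ᴳ U (β (i ↑ˡ k)) ⌋ then suc (ℓa i (xIndex j)) else 0)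
                                     (if ⌊ U b ≟ᴳ U (β (opposite (i ↑ˡ k))) ⌋ then suc (ℓc i (xIndex j)) else 0))
                         (cong₂ _+_ (if-U (i ↑ˡ k) _) (if-U (opposite (i ↑ˡ k)) _))

  vertexSum-V : ∀ t₀ → vertexSum (V t₀) ≡ sumV
  vertexSum-V t₀ = begin
    vertexSum (V t₀)
      ≡⟨ sum-map-entries (weight (V t₀)) ⟩
    ∑[ t < k + k ] weight (V t₀) (uvEntry t) + ∑[ i < k ] ∑[ j < N ] List.sum (map (weight (V t₀)) (xEntries i j))
      ≡⟨ cong₂ _+_ (sum-cong-≗ {x = weight (V t₀) ∘ uvEntry} weight-uv)
                   (sum-cong-≗ {x = λ i → ∑[ j < N ] List.sum (map (weight (V t₀)) (xEntries i j))}
                               (λ i → sum-cong-≗ {x = λ j → List.sum (map (weight (V t₀)) (xEntries i j))} (weight-x i))) ⟩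
    ∑[ t < k + k ] (ω t * suc (uvLabel t))
      + ∑[ i < k ] ∑[ j < N ] (ω (i ↑ˡ k) * suc (ℓb i (xIndex j)) + ω (opposite (i ↑ˡ k)) * suc (ℓd i (xIndex j)))
      ≡⟨ ∑-rows ω (suc ∘ uvLabel) (λ i j → suc (ℓb i (xIndex j))) (λ i j → suc (ℓd i (xIndex j))) sumV-left sumV-right ⟩
    sumV * ∑[ t < k + k ] ω t
      ≡⟨ cong (sumV *_) (trans (∑-single ω t₀ (λ t t≢t₀ → cong indicator (⌊⌋-false (t₀ Fin.≟ t) (t≢t₀ ∘ sym))))
                               (cong indicator (⌊⌋-true (t₀ Fin.≟ t₀) refl))) ⟩
    sumV * 1
      ≡⟨ *-identityʳ sumV ⟩
    sumV ∎
    where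
    open ≡-Reasoning
    ω : Fin (k + k) → ℕ
    ω t = indicator ⌊ t₀ Fin.≟ t ⌋
    if-V : ∀ t l → (if ⌊ V t₀ ≟ᴳ V t ⌋ then l else 0) ≡ ω t * l
    if-V t l = trans (cong (λ c → if c then l else 0) (⌊V≟V⌋ t₀ t)) (if-then-0 _ l)
    weight-uv : ∀ t → weight (V t₀) (uvEntry t) ≡ ω t * suc (uvLabel t)
    weight-uv t = if-V t _
    weight-x : ∀ i j → List.sum (map (weight (V t₀)) (xEntries i j))
                     ≡ ω (i ↑ˡ k) * suc (ℓb i (xIndex j)) + ω (opposite (i ↑ˡ k)) * suc (ℓd i (xIndex j))
    weight-x i j = trans (drop-zeros (if ⌊ V t₀ ≟ᴳ V (i ↑ˡ k) ⌋ then suc (ℓb i (xIndex j)) else 0)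
                                     (if ⌊ V t₀ ≟ᴳ V (opposite (i ↑ˡ k)) ⌋ then suc (ℓd i (xIndex j)) else 0))
                         (cong₂ _+_ (if-V (i ↑ˡ k) _) (if-V (opposite (i ↑ˡ k)) _))

  vertexSum-X : ∀ i₀ j₀ → vertexSum (X i₀ j₀) ≡ sumX
  vertexSum-X i₀ j₀ = begin
    vertexSum (X i₀ j₀)
      ≡⟨ sum-map-entries (weight (X i₀ j₀)) ⟩
    ∑[ t < k + k ] 0 + ∑[ i < k ] ∑[ j < N ] List.sum (map (weight (X i₀ j₀)) (xEntries i j))
      ≡⟨ cong (_+ ∑[ i < k ] ∑[ j < N ] List.sum (map (weight (X i₀ j₀)) (xEntries i j))) (sum-replicate-zero (k + k)) ⟩
    ∑[ i < k ] ∑[ j < N ] List.sum (map (weight (X i₀ j₀)) (xEntries i j))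
      ≡⟨ ∑-single _ i₀ (λ i i≢i₀ → trans (sum-cong-≗ {x = λ j → List.sum (map (weight (X i₀ j₀)) (xEntries i j))}
                                                   (λ j → trans (weight-x i j) (if-false λ { refl → i≢i₀ refl })))
                                        (sum-replicate-zero N)) ⟩
    ∑[ j < N ] List.sum (map (weight (X i₀ j₀)) (xEntries i₀ j))
      ≡⟨ ∑-single _ j₀ (λ j j≢j₀ → trans (weight-x i₀ j) (if-false (λ { refl → j≢j₀ refl }))) ⟩
    List.sum (map (weight (X i₀ j₀)) (xEntries i₀ j₀))
      ≡⟨ trans (weight-x i₀ j₀) (cong (λ c → if c then _ else 0) (⌊⌋-true (X i₀ j₀ ≟ᴳ X i₀ j₀) refl)) ⟩
    column-sum i₀ j₀
      ≡⟨ sumX-column i₀ (xIndex j₀) ⟩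
    sumX ∎
    where
    open ≡-Reasoning
    column-sum : Fin k → Fin N → ℕ
    column-sum i j = suc (ℓa i (xIndex j)) + suc (ℓb i (xIndex j)) + suc (ℓc i (xIndex j)) + suc (ℓd i (xIndex j))
    weight-x : ∀ i j → List.sum (map (weight (X i₀ j₀)) (xEntries i j))
                     ≡ (if ⌊ X i₀ j₀ ≟ᴳ X i j ⌋ then column-sum i j else 0)
    weight-x i j = if-sum ⌊ X i₀ j₀ ≟ᴳ X i j ⌋ _ _ _ _
    if-false : ∀ {i j} → X i₀ j₀ ≢ X i j → (if ⌊ X i₀ j₀ ≟ᴳ X i j ⌋ then column-sum i j else 0) ≡ 0
    if-false ≢ = cong (λ c → if c then _ else 0) (⌊⌋-false (X i₀ j₀ ≟ᴳ X _ _) ≢)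

  U∈vertices : ∀ b → U b ∈ verticesG k n m
  U∈vertices b = Any.++⁺ˡ (∈-map⁺ U (∈-allFin b))

  V∈vertices : ∀ t → V t ∈ verticesG k n m
  V∈vertices t = Any.++⁺ʳ (map U (allFin m)) (Any.++⁺ˡ (∈-map⁺ V (∈-allFin t)))

  X∈vertices : ∀ i j → X i j ∈ verticesG k n m
  X∈vertices i j = Any.++⁺ʳ (map U (allFin m)) (Any.++⁺ʳ (map V (allFin (k + k)))
    (Any.concatMap⁺ (λ i → map (X i) (allFin N)) (any-allFin i (∈-map⁺ (X i) (∈-allFin j)))))

  entry∈edges : ∀ {z} → z ∈ entries → proj₁ z ∈ edgesG k n m β
  entry∈edges z∈ = subst (_ ∈_) entries-edges (∈-map⁺ proj₁ z∈)

  triangle⇒three-colours : ∀ i j {f} → IsLocalAntimagic _≟ᴳ_ (verticesG k n m) (edgesG k n m β) f →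
    3 ≤ numColours _≟ᴳ_ (verticesG k n m) (edgesG k n m β) f
  triangle⇒three-colours i j antimagic = triangle⇒3≤numColours antimagic
    (U∈vertices (β (i ↑ˡ k))) (V∈vertices (i ↑ˡ k)) (X∈vertices i j)
    (entry∈edges (any-uvEntry (i ↑ˡ k) refl))
    (entry∈edges (any-xEntries i j (here refl)))
    (entry∈edges (any-xEntries i j (there (here refl))))

  module _ {s} (blocks : AllBlocksOfSize k m β s) where

    colour : VG k n m → ℕ
    colour (U _)   = sumU * s
    colour (V _)   = sumV
    colour (X _ _) = sumX

    vertexSum≡colour : ∀ w → vertexSum w ≡ colour w
    vertexSum≡colour (U b)   = trans (vertexSum-U b) (cong (sumU *_) (blocks b))
    vertexSum≡colour (V t)   = vertexSum-V t
    vertexSum≡colour (X i j) = vertexSum-X i j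

    three-colour-labelling : sumU * s ≢ sumV → sumU * s ≢ sumX → sumV ≢ sumX → Fin k →
      Σ (Fin (length (edgesG k n m β)) → Fin (length (edgesG k n m β))) λ f →
        IsLocalAntimagic _≟ᴳ_ (verticesG k n m) (edgesG k n m β) f ×
        numColours _≟ᴳ_ (verticesG k n m) (edgesG k n m β) f ≡ 3
    three-colour-labelling U≢V U≢X V≢X i =
      subst (λ es → Σ (Fin (length es) → Fin (length es)) λ f →
                      IsLocalAntimagic _≟ᴳ_ (verticesG k n m) es f × numColours _≟ᴳ_ (verticesG k n m) es f ≡ 3)
            entries-edges
            (f , labelling-isLocalAntimagic entries entries-bounded entries-onto colour vertexSum≡colour proper
               , trans (numColours-labelling entries entries-bounded colour vertexSum≡colour)
                       (≤-antisym (length-deduplicate-≤ colours⊆)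
                                  (three≤length-deduplicate (∈-map⁺ colour (U∈vertices (β (i ↑ˡ k))))
                                                            (∈-map⁺ colour (V∈vertices (i ↑ˡ k)))
                                                            (∈-map⁺ colour (X∈vertices i zero)) U≢V U≢X V≢X)))
      where
      f = labelling entries entries-bounded
      proper : All (λ e → colour (proj₁ e) ≢ colour (proj₂ e)) (map proj₁ entries)
      proper = AllP.map⁺ (All-entries (λ _ → U≢V) (λ _ _ → U≢X ∷ V≢X ∷ U≢X ∷ V≢X ∷ []))
      colours⊆ : map colour (verticesG k n m) ⊆ sumU * s ∷ sumV ∷ sumX ∷ []
      colours⊆ c∈ with ∈-map⁻ colour c∈
      ... | U _   , _ , refl = here refl
      ... | V _   , _ , refl = there (here refl)
      ... | X _ _ , _ , refl = there (there (here refl))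

-- The identities below are the definitions of sumU, sumV, sumX unfolded for the ring solver.
sumX<sumV : ∀ a b → Labels.sumX (suc a) (suc b) < Labels.sumV (suc a) (suc b)
sumX<sumV a b = subst (Labels.sumX (suc a) (suc b) <_) (identity a b) (m<m+n _ z<s)
  where
  identity : ∀ a b →
    (suc (suc a) + suc a * (suc b * 4 + (suc b * 4 + 2) + 5)) + (suc (suc a) + suc a * (suc b * 4 + (suc b * 4 + 2) + 1))
      + suc (b * (suc (suc a) + suc a * (suc b * 4 + (suc b * 4 + 2) + 5)) + a)
    ≡ (suc (suc a) + suc a * (suc b * 4 + (suc b * 4 + 2) + 2)) + suc b * (suc (suc a) + suc a * (suc b * 4 + (suc b * 4 + 2) + 5))
  identity = solve-∀

sumV<2sumU : ∀ k n → Labels.sumV k n < 2 * Labels.sumU k n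
sumV<2sumU k n = subst (Labels.sumV k n <_) (identity k n) (m<m+n _ z<s)
  where
  identity : ∀ k n →
    ((suc k + k * (n * 4 + (n * 4 + 2) + 2)) + n * (suc k + k * (n * 4 + (n * 4 + 2) + 5))) + suc (n + k * (8 * n * n + 8 * n + 9))
    ≡ 2 * ((suc k + k * (n * 4 + (n * 4 + 2) + 4)) + n * (suc k + k * (n * 4 + (n * 4 + 2) + 1)))
  identity = solve-∀

theorem3p9 : (k s n : ℕ) → 2 ≤ k → 2 ≤ s → 1 ≤ n →
    (m : ℕ) (β : Fin (k + k) → Fin m) →
    AllBlocksOfSize k m β s →
    BlocksIndependent k n m β →
    ChiLaEq _≟G_ (verticesG k n m) (edgesG k n m β) 3
theorem3p9 k s n (s≤s {n = k′} _) (s≤s (s≤s 0≤s′)) (s≤s {n = n′} _) m β blocks _ =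
  three-colour-labelling blocks (>⇒≢ sumV<sumU·s) (>⇒≢ (<-trans (sumX<sumV k′ n′) sumV<sumU·s))
                                (>⇒≢ (sumX<sumV k′ n′)) zero
  , λ _ → triangle⇒three-colours zero zero
  where
  open Labels k n
  open Construction k n m β
  sumV<sumU·s : sumV < sumU * s
  sumV<sumU·s = <-≤-trans (sumV<2sumU k n) (≤-trans (≤-reflexive (*-comm 2 sumU)) (*-monoʳ-≤ sumU (s≤s (s≤s 0≤s′))))
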